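{- For any proper Christoffel word $w=a\psi(v)b$ (with $v\in\{a,b\}^*$), $$\pi(\psi(v^{\sim}))=\min\{|w|_a,|w|_b\}.$$ In particular, if $v$ begins with the letter $a$, then $\pi(\psi(v^{\sim}))=|\psi(v)|_b+1$.
   Context: Let $\mathcal{A}=\{a,b\}$. For $w\in\mathcal{A}^*$, $|w|_x$ is the number of occurrences of letter $x$ in $w$, $w^{\sim}$ is the reversal of $w$, and $\pi(w)$ is the minimal period of $w$ ($\pi(\varepsilon)=1$). $w^{(+)}$ is the shortest palindrome having $w$ as a prefix; $\psi(\varepsilon)=\varepsilon$, $\psi(vx)=(\psi(v)x)^{(+)}$. For coprime positive integers $p,q$ with $n=p+q$, the Christoffel word of slope $p/q$ is $x_1\cdots x_n$ where $x_i=a$ if $ip \bmod n>(i-1)p\bmod n$ and $x_i=b$ otherwise; these are the proper Christoffel words (they satisfy $|w|_b=p$, $|w|_a=q$). Every proper Christoffel word can be written uniquely as $a\psi(v)b$ with $v\in\mathcal{A}^*$. -}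

module Defs where

open import Data.Nat using (ℕ; zero; suc; _+_; _*_; _<ᵇ_)
open import Data.Nat.DivMod using (_%_)
open import Data.Bool using (Bool; true; false; if_then_else_; _∧_)
open import Data.List using (List; []; _∷_; _++_; length; reverse; take; drop; map; upTo)

data Letter : Set where
  a b : Letter

_==ᴸ_ : Letter → Letter → Bool
a ==ᴸ a = true
b ==ᴸ b = true
_ ==ᴸ _ = false

Word : Set
Word = List Letter

count : Letter → Word → ℕ
count x [] = 0
count x (y ∷ w) = if x ==ᴸ y then suc (count x w) else count x w

_==ᵂ_ : Word → Word → Bool
[] ==ᵂ [] = true
(x ∷ u) ==ᵂ (y ∷ v) = (x ==ᴸ y) ∧ (u ==ᵂ v)
_ ==ᵂ _ = false

isPrefixᵇ : Word → Word → Bool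
isPrefixᵇ [] _ = true
isPrefixᵇ (x ∷ u) [] = false
isPrefixᵇ (x ∷ u) (y ∷ v) = (x ==ᴸ y) ∧ isPrefixᵇ u v

-- p is a period of w iff w_i = w_{i+p} for all valid i,
-- i.e. iff (drop p w) is a prefix of w.
hasPeriodᵇ : ℕ → Word → Bool
hasPeriodᵇ p w = isPrefixᵇ (drop p w) w

-- π(w): least p ≥ 1 that is a period of w (search p = 1,2,...;
-- |w| is always a period, and π(ε) = 1).
minPeriodSearch : ℕ → ℕ → Word → ℕ
minPeriodSearch zero p w = p
minPeriodSearch (suc k) p w = if hasPeriodᵇ p w then p else minPeriodSearch k (suc p) w

π : Word → ℕ
π w = minPeriodSearch (length w) 1 w

isPalᵇ : Word → Bool
isPalᵇ w = reverse w ==ᵂ w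

-- w^(+): shortest palindrome having w as a prefix.  A word of length
-- |w| + i having w as prefix and being a palindrome is necessarily
-- w ++ reverse (take i w); we search the least such i (i = |w| works).
closureSearch : ℕ → ℕ → Word → Word
closureSearch zero i w = w ++ reverse (take i w)
closureSearch (suc k) i w =
  if isPalᵇ (w ++ reverse (take i w)) then w ++ reverse (take i w)
  else closureSearch k (suc i) w

palClosure : Word → Word
palClosure w = closureSearch (length w) 0 w

-- ψ(ε) = ε, ψ(v x) = (ψ(v) x)^(+)
ψAcc : Word → Word → Word
ψAcc acc [] = acc
ψAcc acc (x ∷ v) = ψAcc (palClosure (acc ++ (x ∷ []))) v

ψ : Word → Word
ψ v = ψAcc [] v

-- Christoffel word of slope p/q, n = p + q: x_i = a iff i p mod n > (i-1) p mod n
christoffel : ℕ → ℕ → Word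
christoffel p q = go (p + q)
  where
  letterAt : ℕ → ℕ → Letter   -- letterAt m j : letter x_{j+1}, n = suc m
  letterAt m j = if ((j * p) % suc m) <ᵇ ((suc j * p) % suc m) then a else b
  go : ℕ → Word
  go zero = []
  go (suc m) = map (letterAt m) (upTo (suc m))

module Submission where

-- Every ψ(v) is a "central" palindrome: of length α + β, with coprime periods α + 1
-- and β + 1, and the letter a at position β, b at position α.  By the theorem of Fine
-- and Wilf its least period is min(α + 1, β + 1).  Appending a letter x and closing
-- under palindromes keeps this shape: the longest palindromic suffix of ψ(v) x has
-- length α + 1 (resp. β + 1), again by Fine–Wilf, which determines the closure.
-- Along the construction we track the 2×2 matrix M(v), the product of the elementary
-- matrices of the letters of v: its column sums are α + 1, β + 1 and its row sums are
-- |ψ(v)|_a + 1, |ψ(v)|_b + 1.  Since M(ṽ) is the anti-transpose of M(v), the periods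
-- of ψ(ṽ) are |ψ(v)|_a + 1 and |ψ(v)|_b + 1, i.e. |w|_a and |w|_b.  If v starts with
-- a, the rows of M(v) are ordered, so the minimum is |ψ(v)|_b + 1.

open import Defs
open import Data.Bool using (Bool; true; false; _∧_; if_then_else_)
open import Data.Empty using (⊥; ⊥-elim)
open import Data.List using (List; []; _∷_; _++_; length; reverse; take; drop)
open import Data.List.Properties
  using (length-++; length-reverse; length-take; length-drop; reverse-++; unfold-reverse;
         reverse-involutive; take++drop≡id; ++-assoc; ++-cancelˡ; ++-cancelʳ)
open import Data.Maybe using (Maybe; just; nothing)
open import Data.Maybe.Properties using (just-injective)
open import Data.Nat using (ℕ; zero; suc; >-nonZero; _+_; _*_; _∸_; _≤_; _<_; _⊓_; z≤n; s≤s; _<?_; _≤?_; _≟_)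
open import Data.Nat.Properties
open import Data.Nat.Coprimality using (Coprime; coprime-+; 1-coprimeTo) renaming (sym to coprime-sym)
open import Data.Nat.Divisibility using (_∣_; divides; ∣-antisym; ∣-refl; ∣-trans; ∣m+n∣m⇒∣n; ∣m∣n⇒∣m+n; ∣⇒≤)
open import Data.Nat.GCD using (gcd; gcd[m,n]∣m; gcd[m,n]∣n; gcd[m,n]≤n; gcd-greatest; gcd-comm)
open import Data.Nat.Induction using (<-rec)
open import Data.Nat.Solver using (module +-*-Solver)
open import Algebra.Properties.CommutativeSemigroup +-commutativeSemigroup using (interchange)
open import Data.Product using (_×_; _,_; ∃; proj₁; proj₂)
open import Data.Sum using (inj₁; inj₂)
open import Relation.Binary using (Tri; tri<; tri≈; tri>)
open import Relation.Binary.PropositionalEquality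
open import Relation.Nullary using (¬_; Dec; yes; no)
open +-*-Solver using (solve; _:+_; con; _:=_)

private
  variable
    A : Set

infixl 20 _‼_
_‼_ : List A → ℕ → Maybe A
[] ‼ _ = nothing
(x ∷ w) ‼ zero = just x
(x ∷ w) ‼ suc i = w ‼ i

‼-ext : (u v : List A) → (∀ i → u ‼ i ≡ v ‼ i) → u ≡ v
‼-ext [] [] h = refl
‼-ext [] (y ∷ v) h with h 0
... | ()
‼-ext (x ∷ u) [] h with h 0
... | ()
‼-ext (x ∷ u) (y ∷ v) h with h 0
... | refl = cong (x ∷_) (‼-ext u v (λ i → h (suc i)))

‼-out : (u : List A) (i : ℕ) → length u ≤ i → u ‼ i ≡ nothing
‼-out [] i _ = refl
‼-out (x ∷ u) (suc i) (s≤s h) = ‼-out u i h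

‼-in : (u : List A) (i : ℕ) → i < length u → ∃ λ x → u ‼ i ≡ just x
‼-in (x ∷ u) zero _ = x , refl
‼-in (x ∷ u) (suc i) (s≤s h) = ‼-in u i h

‼-just⇒< : (u : List A) (i : ℕ) {x : A} → u ‼ i ≡ just x → i < length u
‼-just⇒< (y ∷ u) zero _ = s≤s z≤n
‼-just⇒< (y ∷ u) (suc i) h = s≤s (‼-just⇒< u i h)

‼-++ˡ : (u v : List A) (i : ℕ) → i < length u → (u ++ v) ‼ i ≡ u ‼ i
‼-++ˡ (x ∷ u) v zero _ = refl
‼-++ˡ (x ∷ u) v (suc i) (s≤s h) = ‼-++ˡ u v i h

‼-++ʳ : (u v : List A) (i : ℕ) → (u ++ v) ‼ (length u + i) ≡ v ‼ i
‼-++ʳ [] v i = refl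
‼-++ʳ (x ∷ u) v i = ‼-++ʳ u v i

‼-take : (n : ℕ) (w : List A) (i : ℕ) → i < n → take n w ‼ i ≡ w ‼ i
‼-take (suc n) [] i _ = refl
‼-take (suc n) (x ∷ w) zero _ = refl
‼-take (suc n) (x ∷ w) (suc i) (s≤s h) = ‼-take n w i h

‼-drop : (n : ℕ) (w : List A) (i : ℕ) → drop n w ‼ i ≡ w ‼ (n + i)
‼-drop zero w i = refl
‼-drop (suc n) [] i = refl
‼-drop (suc n) (x ∷ w) i = ‼-drop n w i

‼-reverse : (w : List A) (i j : ℕ) → suc (i + j) ≡ length w → reverse w ‼ i ≡ w ‼ j
‼-reverse (x ∷ w) i zero e rewrite unfold-reverse x w =
  trans (cong ((reverse w ++ x ∷ []) ‼_) i≡) (‼-++ʳ (reverse w) (x ∷ []) 0)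
  where
  i≡ : i ≡ length (reverse w) + 0
  i≡ = trans (sym (+-identityʳ i)) (trans (suc-injective e) (sym (trans (+-identityʳ _) (length-reverse w))))
‼-reverse (x ∷ w) i (suc j) e rewrite unfold-reverse x w =
  trans (‼-++ˡ (reverse w) (x ∷ []) i i<) (‼-reverse w i j e′)
  where
  e′ : suc (i + j) ≡ length w
  e′ = suc-injective (trans (cong suc (sym (+-suc i j))) e)
  i< : i < length (reverse w)
  i< = subst (i <_) (sym (length-reverse w)) (subst (i <_) e′ (s≤s (m≤m+n i j)))

length-take≤ : (n : ℕ) (w : List A) → n ≤ length w → length (take n w) ≡ n
length-take≤ n w n≤ = trans (length-take n w) (m≤n⇒m⊓n≡m n≤)

take-++ˡ : (j : ℕ) (u v : List A) → j ≤ length u → take j (u ++ v) ≡ take j u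
take-++ˡ zero u v _ = refl
take-++ˡ (suc j) (x ∷ u) v (s≤s h) = cong (x ∷_) (take-++ˡ j u v h)

take-++ʳ : (u v : List A) (k : ℕ) → take (length u + k) (u ++ v) ≡ u ++ take k v
take-++ʳ [] v k = refl
take-++ʳ (y ∷ u) v k = cong (y ∷_) (take-++ʳ u v k)

drop-++ˡ : (j : ℕ) (u v : List A) → j ≤ length u → drop j (u ++ v) ≡ drop j u ++ v
drop-++ˡ zero u v _ = refl
drop-++ˡ (suc j) (x ∷ u) v (s≤s h) = drop-++ˡ j u v h

length-drop+ : (j : ℕ) (u : List A) → j ≤ length u → length (drop j u) + j ≡ length u
length-drop+ j u j≤ = trans (cong (_+ j) (length-drop j u)) (m∸n+n≡m j≤)

==ᴸ-sound : (x y : Letter) → (x ==ᴸ y) ≡ true → x ≡ y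
==ᴸ-sound a a _ = refl
==ᴸ-sound b b _ = refl

==ᴸ-refl : (x : Letter) → (x ==ᴸ x) ≡ true
==ᴸ-refl a = refl
==ᴸ-refl b = refl

∧-true : (p q : Bool) → (p ∧ q) ≡ true → (p ≡ true) × (q ≡ true)
∧-true true true _ = refl , refl

==ᵂ-sound : (u v : Word) → (u ==ᵂ v) ≡ true → u ≡ v
==ᵂ-sound [] [] _ = refl
==ᵂ-sound (x ∷ u) (y ∷ v) h with ∧-true (x ==ᴸ y) (u ==ᵂ v) h
... | hx , hu = cong₂ _∷_ (==ᴸ-sound x y hx) (==ᵂ-sound u v hu)

==ᵂ-refl : (u : Word) → (u ==ᵂ u) ≡ true
==ᵂ-refl [] = refl
==ᵂ-refl (x ∷ u) rewrite ==ᴸ-refl x = ==ᵂ-refl u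

isPrefix-sound : (u w : Word) → isPrefixᵇ u w ≡ true → ∀ i x → u ‼ i ≡ just x → w ‼ i ≡ just x
isPrefix-sound (y ∷ u) (z ∷ w) h i x e with ∧-true (y ==ᴸ z) (isPrefixᵇ u w) h
isPrefix-sound (y ∷ u) (z ∷ w) h zero x e | hy , _ = trans (cong just (sym (==ᴸ-sound y z hy))) e
isPrefix-sound (y ∷ u) (z ∷ w) h (suc i) x e | _ , hu = isPrefix-sound u w hu i x e

isPrefix-complete : (u w : Word) → (∀ i x → u ‼ i ≡ just x → w ‼ i ≡ just x) → isPrefixᵇ u w ≡ true
isPrefix-complete [] w h = refl
isPrefix-complete (y ∷ u) [] h with h 0 y refl
... | ()
isPrefix-complete (y ∷ u) (z ∷ w) h with h 0 y refl
... | refl rewrite ==ᴸ-refl y = isPrefix-complete u w (λ i x e → h (suc i) x e)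

IsPal : List A → Set
IsPal w = reverse w ≡ w

isPal-true : (w : Word) → IsPal w → isPalᵇ w ≡ true
isPal-true w e = subst (λ z → (z ==ᵂ w) ≡ true) (sym e) (==ᵂ-refl w)

isPal-false : (w : Word) → ¬ IsPal w → isPalᵇ w ≡ false
isPal-false w ¬pal with isPalᵇ w in eq
... | true = ⊥-elim (¬pal (==ᵂ-sound (reverse w) w eq))
... | false = refl

Mirror : List A → Set
Mirror s = ∀ i j → suc (i + j) ≡ length s → s ‼ i ≡ s ‼ j

pal⇒mirror : (s : List A) → IsPal s → Mirror s
pal⇒mirror s pal i j e = trans (sym (cong (_‼ i) pal)) (‼-reverse s i j e)

mirror⇒pal : (s : List A) → Mirror s → IsPal s
mirror⇒pal s mirror = ‼-ext (reverse s) s same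
  where
  same : ∀ i → reverse s ‼ i ≡ s ‼ i
  same i with i <? length s
  ... | yes i< = trans (‼-reverse s i j e) (sym (mirror i j e))
    where
    j = length s ∸ suc i
    e : suc (i + j) ≡ length s
    e = m+[n∸m]≡n i<
  ... | no i≮ = trans (‼-out (reverse s) i (subst (_≤ i) (sym (length-reverse s)) (≮⇒≥ i≮)))
                      (sym (‼-out s i (≮⇒≥ i≮)))

-- Periods and the minimal period π

PeriodUpTo : ℕ → ℕ → List A → Set
PeriodUpTo p L w = ∀ i → i + p < L → w ‼ i ≡ w ‼ (i + p)

Period : ℕ → List A → Set
Period p w = PeriodUpTo p (length w) w

hasPeriod-sound : (p : ℕ) (w : Word) → hasPeriodᵇ p w ≡ true → Period p w
hasPeriod-sound p w h i i+p< with ‼-in w (i + p) i+p<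
... | x , e = trans (isPrefix-sound (drop p w) w h i x shifted) (sym e)
  where
  shifted : drop p w ‼ i ≡ just x
  shifted = trans (‼-drop p w i) (trans (cong (w ‼_) (+-comm p i)) e)

hasPeriod-complete : (p : ℕ) (w : Word) → Period p w → hasPeriodᵇ p w ≡ true
hasPeriod-complete p w per = isPrefix-complete (drop p w) w letters
  where
  letters : ∀ i x → drop p w ‼ i ≡ just x → w ‼ i ≡ just x
  letters i x e = trans (per i (‼-just⇒< w (i + p) e′)) e′
    where
    e′ : w ‼ (i + p) ≡ just x
    e′ = trans (cong (w ‼_) (+-comm i p)) (trans (sym (‼-drop p w i)) e)

hasPeriod-false : (p : ℕ) (w : Word) → ¬ Period p w → hasPeriodᵇ p w ≡ false
hasPeriod-false p w ¬per with hasPeriodᵇ p w in eq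
... | true = ⊥-elim (¬per (hasPeriod-sound p w eq))
... | false = refl

minPeriodSearch-least : (k p d : ℕ) (w : Word) → p ≤ d → d ≤ p + k → Period d w →
                        (∀ e → p ≤ e → e < d → ¬ Period e w) → minPeriodSearch k p w ≡ d
minPeriodSearch-least zero p d w p≤d d≤ _ _ = ≤-antisym p≤d (subst (d ≤_) (+-identityʳ p) d≤)
minPeriodSearch-least (suc k) p d w p≤d d≤ per least with p ≟ d
... | yes refl rewrite hasPeriod-complete p w per = refl
... | no p≢d rewrite hasPeriod-false p w (least p ≤-refl (≤∧≢⇒< p≤d p≢d)) =
  minPeriodSearch-least k (suc p) d w (≤∧≢⇒< p≤d p≢d) (subst (d ≤_) (+-suc p k) d≤) per
    (λ e p<e e<d → least e (≤-trans (n≤1+n p) p<e) e<d)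

π-least : (d : ℕ) (w : Word) → 1 ≤ d → d ≤ suc (length w) → Period d w →
          (∀ e → 1 ≤ e → e < d → ¬ Period e w) → π w ≡ d
π-least d w = minPeriodSearch-least (length w) 1 d w

-- Palindromic closure

module _ (i : ℕ) (w : List A) where
  private
    P = take i w
    D = drop i w

    reverse-extension : reverse (w ++ reverse P) ≡ P ++ (reverse D ++ reverse P)
    reverse-extension = begin
      reverse (w ++ reverse P)           ≡⟨ reverse-++ w (reverse P) ⟩
      reverse (reverse P) ++ reverse w   ≡⟨ cong₂ _++_ (reverse-involutive P) (cong reverse (sym (take++drop≡id i w))) ⟩
      P ++ reverse (P ++ D)              ≡⟨ cong (P ++_) (reverse-++ P D) ⟩
      P ++ (reverse D ++ reverse P)      ∎
      where open ≡-Reasoning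

    extension : w ++ reverse P ≡ P ++ (D ++ reverse P)
    extension = trans (cong (_++ reverse P) (sym (take++drop≡id i w))) (++-assoc P D (reverse P))

  pal-extension⇒pal-suffix : IsPal (w ++ reverse P) → IsPal D
  pal-extension⇒pal-suffix pal =
    ++-cancelʳ (reverse P) (reverse D) D
      (++-cancelˡ P _ _ (trans (sym reverse-extension) (trans pal extension)))

  pal-suffix⇒pal-extension : IsPal D → IsPal (w ++ reverse P)
  pal-suffix⇒pal-extension pal =
    trans reverse-extension (trans (cong (λ z → P ++ (z ++ reverse P)) pal) (sym extension))

closureSearch-least : (k i i₀ : ℕ) (w : Word) → i ≤ i₀ → i₀ ≤ i + k →
                      (∀ j → i ≤ j → j < i₀ → ¬ IsPal (drop j w)) → IsPal (drop i₀ w) →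
                      closureSearch k i w ≡ w ++ reverse (take i₀ w)
closureSearch-least zero i i₀ w i≤ ≤i _ _ with ≤-antisym i≤ (subst (i₀ ≤_) (+-identityʳ i) ≤i)
... | refl = refl
closureSearch-least (suc k) i i₀ w i≤ ≤i least pal with i ≟ i₀
... | yes refl rewrite isPal-true (w ++ reverse (take i w)) (pal-suffix⇒pal-extension i w pal) = refl
... | no i≢i₀ rewrite isPal-false (w ++ reverse (take i w))
                        (λ p → least i ≤-refl (≤∧≢⇒< i≤ i≢i₀) (pal-extension⇒pal-suffix i w p)) =
  closureSearch-least k (suc i) i₀ w (≤∧≢⇒< i≤ i≢i₀) (subst (i₀ ≤_) (+-suc i k) ≤i)
    (λ j i<j j< → least j (≤-trans (n≤1+n i) i<j) j<) pal

palClosure-char : (i₀ : ℕ) (w : Word) → i₀ ≤ length w →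
                  (∀ j → j < i₀ → ¬ IsPal (drop j w)) → IsPal (drop i₀ w) →
                  palClosure w ≡ w ++ reverse (take i₀ w)
palClosure-char i₀ w i₀≤ least = closureSearch-least (length w) 0 i₀ w z≤n i₀≤ (λ j _ → least j)

-- The theorem of Fine and Wilf

gcd-self : ∀ p → gcd p p ≡ p
gcd-self p = ∣-antisym (gcd[m,n]∣m p p) (gcd-greatest ∣-refl ∣-refl)

gcd-plus : ∀ p r → gcd p (p + r) ≡ gcd p r
gcd-plus p r = ∣-antisym
  (gcd-greatest (gcd[m,n]∣m p (p + r)) (∣m+n∣m⇒∣n (gcd[m,n]∣n p (p + r)) (gcd[m,n]∣m p (p + r))))
  (gcd-greatest (gcd[m,n]∣m p r) (∣m∣n⇒∣m+n (gcd[m,n]∣m p r) (gcd[m,n]∣n p r)))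

gcd-pos : ∀ m n → 1 ≤ n → 1 ≤ gcd m n
gcd-pos m n 1≤n with gcd m n | gcd[m,n]∣n m n
... | zero | divides k n≡ = ⊥-elim (<⇒≱ 1≤n (≤-reflexive (trans n≡ (*-zeroʳ k))))
... | suc _ | _ = s≤s z≤n

module _ {A : Set} where

  period-iterate : (g L : ℕ) (w : List A) → PeriodUpTo g L w →
                   ∀ m j → j + m * g < L → w ‼ j ≡ w ‼ (j + m * g)
  period-iterate g L w per zero j _ = cong (w ‼_) (sym (+-identityʳ j))
  period-iterate g L w per (suc m) j j+< =
    trans (per j (≤-<-trans (+-monoʳ-≤ j (m≤m+n g (m * g))) j+<))
      (trans (period-iterate g L w per m (j + g) (subst (_< L) (sym (+-assoc j g (m * g))) j+<))
        (cong (w ‼_) (+-assoc j g (m * g))))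

  period-take : (p n : ℕ) (w : List A) → Period p w → Period p (take n w)
  period-take p n w per i i+p< =
    trans (‼-take n w i (≤-<-trans (m≤m+n i p) <n))
      (trans (per i <w) (sym (‼-take n w (i + p) <n)))
    where
    i+p<⊓ : i + p < n ⊓ length w
    i+p<⊓ = subst (i + p <_) (length-take n w) i+p<
    <n = m<n⊓o⇒m<n n (length w) i+p<⊓
    <w = m<n⊓o⇒m<o n (length w) i+p<⊓

  extend-period : (g m L : ℕ) (w : List A) → 1 ≤ g → suc m * g ≤ L →
                  Period (suc m * g) w → PeriodUpTo g L w → Period g w
  extend-period g m L w 1≤g p≤L perP perG = <-rec Goal step
    where
    p = suc m * g
    Goal : ℕ → Set
    Goal i = i + g < length w → w ‼ i ≡ w ‼ (i + g)
    step : ∀ i → (∀ {i′} → i′ < i → Goal i′) → Goal i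
    step i ih i+g< with i + g <? L | p ≤? i
    ... | yes inPrefix | _ = perG i inPrefix
    ... | no _ | yes p≤i = begin
          w ‼ i             ≡⟨ cong (w ‼_) (sym e) ⟩
          w ‼ (i′ + p)      ≡⟨ sym (perP i′ (subst (_< length w) (sym e) (≤-<-trans (m≤m+n i g) i+g<))) ⟩
          w ‼ i′            ≡⟨ ih i′<i (≤-<-trans (+-monoˡ-≤ g (<⇒≤ i′<i)) i+g<) ⟩
          w ‼ (i′ + g)      ≡⟨ perP (i′ + g) (subst (_< length w) (sym e′) i+g<) ⟩
          w ‼ (i′ + g + p)  ≡⟨ cong (w ‼_) e′ ⟩
          w ‼ (i + g)       ∎
      where
      open ≡-Reasoning
      i′ = i ∸ p
      e : i′ + p ≡ i
      e = m∸n+n≡m p≤i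
      e′ : i′ + g + p ≡ i + g
      e′ = trans (+-assoc i′ g p) (trans (cong (i′ +_) (+-comm g p)) (trans (sym (+-assoc i′ p g)) (cong (_+ g) e)))
      i′<i : i′ < i
      i′<i = subst (i′ <_) e (m<m+n i′ (≤-trans 1≤g (m≤m+n g (m * g))))
    ... | no outside | no p≰i = begin
          w ‼ i             ≡⟨ cong (w ‼_) (sym e′) ⟩
          w ‼ (j + m * g)   ≡⟨ sym (period-iterate g L w perG m j (subst (_< L) (sym e′) (<-≤-trans (≰⇒> p≰i) p≤L))) ⟩
          w ‼ j             ≡⟨ perP j (subst (_< length w) (sym e) i+g<) ⟩
          w ‼ (j + p)       ≡⟨ cong (w ‼_) e ⟩
          w ‼ (i + g)       ∎
      where
      open ≡-Reasoning
      j = i + g ∸ p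
      e : j + p ≡ i + g
      e = m∸n+n≡m (≤-trans p≤L (≮⇒≥ outside))
      e′ : j + m * g ≡ i
      e′ = +-cancelʳ-≡ g (j + m * g) i (trans (+-assoc j (m * g) g) (trans (cong (j +_) (+-comm (m * g) g)) e))

  period-difference : ∀ p r (w : List A) → p ≤ length w → Period p w → Period (p + r) w →
                      Period r (take (length w ∸ p) w)
  period-difference p r w p≤ perP perQ i i+r<u = begin
      u ‼ i              ≡⟨ ‼-take L w i (≤-<-trans (m≤m+n i r) i+r<L) ⟩
      w ‼ i              ≡⟨ perQ i (subst (_< length w) (sym e) i+r+p<) ⟩
      w ‼ (i + (p + r))  ≡⟨ cong (w ‼_) e ⟩
      w ‼ (i + r + p)    ≡⟨ sym (perP (i + r) i+r+p<) ⟩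
      w ‼ (i + r)        ≡⟨ sym (‼-take L w (i + r) i+r<L) ⟩
      u ‼ (i + r)        ∎
    where
    open ≡-Reasoning
    L = length w ∸ p
    u = take L w
    i+r<L : i + r < L
    i+r<L = <-≤-trans i+r<u (≤-trans (≤-reflexive (length-take L w)) (m⊓n≤m L (length w)))
    e : i + (p + r) ≡ i + r + p
    e = trans (cong (i +_) (+-comm p r)) (sym (+-assoc i r p))
    i+r+p< : i + r + p < length w
    i+r+p< = subst (i + r + p <_) (m∸n+n≡m p≤) (+-monoˡ-< p i+r<L)

  -- One Euclidean step: Fine–Wilf for the periods (p, r) of all words yields it for
  -- the periods (p, p + r) of w.
  fineWilf-reduce : ∀ p r (w : List A) → 1 ≤ p → 1 ≤ r → Period p w → Period (p + r) w →
    p + (p + r) ≤ length w + gcd p (p + r) →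
    (∀ u → Period p u → Period r u → p + r ≤ length u + gcd p r → Period (gcd p r) u) →
    Period (gcd p (p + r)) w
  fineWilf-reduce p r w 1≤p 1≤r perP perQ bound fw =
    subst (λ d → Period d w) (sym (gcd-plus p r)) (viaDivisor (gcd[m,n]∣m p r))
    where
    n = length w
    g = gcd p r
    L = n ∸ p
    u = take L w
    bound′ : p + (p + r) ≤ n + g
    bound′ = subst (λ d → p + (p + r) ≤ n + d) (gcd-plus p r) bound
    g≤r : g ≤ r
    g≤r = gcd[m,n]≤n p r {{>-nonZero 1≤r}}
    2p≤n : p + p ≤ n
    2p≤n = +-cancelʳ-≤ r (p + p) n
             (subst (_≤ n + r) (sym (+-assoc p p r)) (≤-trans bound′ (+-monoʳ-≤ n g≤r)))
    L+p≡n : L + p ≡ n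
    L+p≡n = m∸n+n≡m (≤-trans (m≤m+n p p) 2p≤n)
    p≤L : p ≤ L
    p≤L = +-cancelʳ-≤ p p L (subst (p + p ≤_) (sym L+p≡n) 2p≤n)
    |u|≡L : length u ≡ L
    |u|≡L = length-take≤ L w (subst (L ≤_) L+p≡n (m≤m+n L p))
    boundᵤ : p + r ≤ length u + g
    boundᵤ = +-cancelˡ-≤ p (p + r) (length u + g) (subst (p + (p + r) ≤_) n+g≡ bound′)
      where
      n+g≡ : n + g ≡ p + (length u + g)
      n+g≡ = trans (cong (_+ g) (trans (sym L+p≡n) (trans (+-comm L p) (cong (p +_) (sym |u|≡L)))))
                   (+-assoc p (length u) g)
    perGᵤ : Period g u
    perGᵤ = fw u (period-take p L w perP) (period-difference p r w (≤-trans (m≤m+n p p) 2p≤n) perP perQ) boundᵤ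
    perG : PeriodUpTo g L w
    perG i i+g<L = trans (sym (‼-take L w i (≤-<-trans (m≤m+n i g) i+g<L)))
                     (trans (perGᵤ i (subst (i + g <_) (sym |u|≡L) i+g<L)) (‼-take L w (i + g) i+g<L))
    viaDivisor : g ∣ p → Period g w
    viaDivisor (divides zero p≡0) = ⊥-elim (<⇒≱ 1≤p (≤-reflexive p≡0))
    viaDivisor (divides (suc m) p≡) =
      extend-period g m L w (gcd-pos p r 1≤r) (subst (_≤ L) p≡ p≤L) (subst (λ d → Period d w) p≡ perP) perG

  FineWilf : ℕ → Set
  FineWilf n = ∀ p q (w : List A) → p + q ≡ n → 1 ≤ p → 1 ≤ q → Period p w → Period q w →
               p + q ≤ length w + gcd p q → Period (gcd p q) w

  -- Fine–Wilf by strong induction on p + q, subtracting the smaller period from the larger.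
  fineWilf-rec : ∀ n → FineWilf n
  fineWilf-rec = <-rec FineWilf step
    where
    step : ∀ n → (∀ {m} → m < n → FineWilf m) → FineWilf n
    step n ih = cases
      where
      ordered : ∀ p q (w : List A) → p < q → p + q ≡ n → 1 ≤ p → Period p w → Period q w →
                p + q ≤ length w + gcd p q → Period (gcd p q) w
      ordered p q w p<q p+q≡n 1≤p perP perQ bound = difference (q ∸ p) (m+[n∸m]≡n (<⇒≤ p<q))
        where
        difference : ∀ r → p + r ≡ q → Period (gcd p q) w
        difference r refl = fineWilf-reduce p r w 1≤p 1≤r perP perQ bound
                              (λ u → ih (subst (p + r <_) p+q≡n (m<n+m (p + r) 1≤p)) p r u refl 1≤p 1≤r)
          where
          1≤r : 1 ≤ r
          1≤r = +-cancelˡ-≤ p 1 r (subst (_≤ p + r) (+-comm 1 p) p<q)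
      cases : FineWilf n
      cases p q w p+q≡n 1≤p 1≤q perP perQ bound = byComparison (<-cmp p q)
        where
        -- (a 'with' on <-cmp p q would also abstract the comparison inside gcd p q)
        byComparison : Tri (p < q) (p ≡ q) (q < p) → Period (gcd p q) w
        byComparison (tri≈ _ p≡q _) = subst (λ d → Period d w) (trans (sym (gcd-self p)) (cong (gcd p) p≡q)) perP
        byComparison (tri< p<q _ _) = ordered p q w p<q p+q≡n 1≤p perP perQ bound
        byComparison (tri> _ _ q<p) = subst (λ d → Period d w) (gcd-comm q p)
          (ordered q p w q<p (trans (+-comm q p) p+q≡n) 1≤q perQ perP
            (subst₂ _≤_ (+-comm p q) (cong (length w +_) (gcd-comm p q)) bound))

  fineWilf : ∀ p q (w : List A) → 1 ≤ p → 1 ≤ q → Period p w → Period q w →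
             p + q ≤ length w + gcd p q → Period (gcd p q) w
  fineWilf p q w = fineWilf-rec (p + q) p q w refl

  fineWilf-coprime : ∀ p q (w : List A) → 1 ≤ p → 1 ≤ q → Period p w → Period q w →
                     Coprime p q → p + q ≤ length w + 1 → Period 1 w
  fineWilf-coprime p q w 1≤p 1≤q perP perQ cop bound =
    subst (λ d → Period d w) gcd≡1 (fineWilf p q w 1≤p 1≤q perP perQ (subst (λ d → p + q ≤ length w + d) (sym gcd≡1) bound))
    where
    gcd≡1 : gcd p q ≡ 1
    gcd≡1 = cop (gcd[m,n]∣m p q , gcd[m,n]∣n p q)

period-one-constant : (s : List A) → Period 1 s → ∀ i → i < length s → s ‼ i ≡ s ‼ 0
period-one-constant s per zero _ = refl
period-one-constant s per (suc i) i< =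
  trans (sym (subst (λ k → s ‼ i ≡ s ‼ k) (+-comm i 1) (per i (subst (_< length s) (+-comm 1 i) i<))))
        (period-one-constant s per i (<-trans (n<1+n i) i<))

pal-suffix⇒period : (s : List A) (j : ℕ) (x : A) → IsPal s → j < length s →
                    IsPal (drop j s ++ x ∷ []) → (s ‼ j ≡ just x) × Period (suc j) s
pal-suffix⇒period s j x pal j< palE = letter , period
  where
  mirrorS = pal⇒mirror s pal
  D = drop j s
  E = D ++ x ∷ []
  mirrorE = pal⇒mirror E palE
  |E| : length E ≡ length D + 1
  |E| = length-++ D
  |D|+j : length D + j ≡ length s
  |D|+j = length-drop+ j s (<⇒≤ j<)
  0<|D| : 0 < length D
  0<|D| = +-cancelʳ-< j 0 (length D) (subst (j <_) (sym |D|+j) j<)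
  letter : s ‼ j ≡ just x
  letter = begin
    s ‼ j               ≡⟨ cong (s ‼_) (sym (+-identityʳ j)) ⟩
    s ‼ (j + 0)         ≡⟨ sym (‼-drop j s 0) ⟩
    D ‼ 0               ≡⟨ sym (‼-++ˡ D (x ∷ []) 0 0<|D|) ⟩
    E ‼ 0               ≡⟨ mirrorE 0 (length D + 0) (trans (cong suc (+-identityʳ (length D))) (trans (+-comm 1 (length D)) (sym |E|))) ⟩
    E ‼ (length D + 0)  ≡⟨ ‼-++ʳ D (x ∷ []) 0 ⟩
    just x              ∎
    where open ≡-Reasoning
  period : Period (suc j) s
  period i i+j+1< = begin
      s ‼ i            ≡⟨ mirrorS i (j + suc c) e₁ ⟩
      s ‼ (j + suc c)  ≡⟨ sym (‼-drop j s (suc c)) ⟩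
      D ‼ suc c        ≡⟨ sym (‼-++ˡ D (x ∷ []) (suc c) c<) ⟩
      E ‼ suc c        ≡⟨ mirrorE (suc c) (suc i) e₂ ⟩
      E ‼ suc i        ≡⟨ ‼-++ˡ D (x ∷ []) (suc i) i< ⟩
      D ‼ suc i        ≡⟨ ‼-drop j s (suc i) ⟩
      s ‼ (j + suc i)  ≡⟨ cong (s ‼_) (solve 2 (λ i j → j :+ (con 1 :+ i) := i :+ (con 1 :+ j)) refl i j) ⟩
      s ‼ (i + suc j)  ∎
    where
    open ≡-Reasoning
    c = length s ∸ suc (i + suc j)
    ec : suc (i + suc j) + c ≡ length s
    ec = m+[n∸m]≡n i+j+1<
    |D|≡ : length D ≡ suc (suc (i + c))
    |D|≡ = +-cancelʳ-≡ j (length D) (suc (suc (i + c)))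
             (trans |D|+j (trans (sym ec) (solve 3 (λ i j c → con 1 :+ (i :+ (con 1 :+ j)) :+ c := con 2 :+ (i :+ c) :+ j) refl i j c)))
    e₁ : suc (i + (j + suc c)) ≡ length s
    e₁ = trans (solve 3 (λ i j c → con 1 :+ (i :+ (j :+ (con 1 :+ c))) := con 1 :+ (i :+ (con 1 :+ j)) :+ c) refl i j c) ec
    c< : suc c < length D
    c< = subst (suc c <_) (sym |D|≡) (s≤s (s≤s (m≤n+m c i)))
    i< : suc i < length D
    i< = subst (suc i <_) (sym |D|≡) (s≤s (s≤s (m≤m+n i c)))
    e₂ : suc (suc c + suc i) ≡ length E
    e₂ = trans (solve 2 (λ i c → con 1 :+ ((con 1 :+ c) :+ (con 1 :+ i)) := con 2 :+ (i :+ c) :+ con 1) refl i c)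
               (trans (cong (_+ 1) (sym |D|≡)) (sym |E|))

-- Central palindromes

record Central (x y : Letter) (α β : ℕ) (s : Word) : Set where
  field
    palindrome : IsPal s
    length≡ : length s ≡ α + β
    period-α : Period (suc α) s
    period-β : Period (suc β) s
    coprime : Coprime (suc α) (suc β)
    letter-β : 1 ≤ α → s ‼ β ≡ just x
    letter-α : 1 ≤ β → s ‼ α ≡ just y

central-swap : ∀ {x y α β s} → Central x y α β s → Central y x β α s
central-swap {α = α} {β} c = record
  { palindrome = palindrome
  ; length≡ = trans length≡ (+-comm α β)
  ; period-α = period-β
  ; period-β = period-α
  ; coprime = coprime-sym coprime
  ; letter-β = letter-α
  ; letter-α = letter-β
  }
  where open Central c

module CentralWord {x y : Letter} {α β : ℕ} {s : Word} (c : Central x y α β s) (x≢y : ¬ x ≡ y) where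
  open Central c

  mirror : Mirror s
  mirror = pal⇒mirror s palindrome

  β≤|s| : β ≤ length s
  β≤|s| = subst (β ≤_) (sym length≡) (m≤n+m β α)

  bound-α : ∀ e → e ≤ β → e + suc α ≤ length s + 1
  bound-α e e≤β = begin
    e + suc α      ≤⟨ +-monoˡ-≤ (suc α) e≤β ⟩
    β + suc α      ≡⟨ solve 2 (λ α β → β :+ (con 1 :+ α) := α :+ β :+ con 1) refl α β ⟩
    α + β + 1      ≡⟨ cong (_+ 1) (sym length≡) ⟩
    length s + 1   ∎
    where open ≤-Reasoning

  bound-β : ∀ e → e ≤ α → e + suc β ≤ length s + 1
  bound-β e e≤α = begin
    e + suc β      ≤⟨ +-monoˡ-≤ (suc β) e≤α ⟩
    α + suc β      ≡⟨ +-suc α β ⟩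
    suc (α + β)    ≡⟨ +-comm 1 (α + β) ⟩
    α + β + 1      ≡⟨ cong (_+ 1) (sym length≡) ⟩
    length s + 1   ∎
    where open ≤-Reasoning

  not-constant : 1 ≤ α → 1 ≤ β → ¬ Period 1 s
  not-constant 1≤α 1≤β per = x≢y (just-injective (begin
      just x  ≡⟨ sym (letter-β 1≤α) ⟩
      s ‼ β   ≡⟨ period-one-constant s per β β< ⟩
      s ‼ 0   ≡⟨ sym (period-one-constant s per α α<) ⟩
      s ‼ α   ≡⟨ letter-α 1≤β ⟩
      just y  ∎))
    where
    open ≡-Reasoning
    β< : β < length s
    β< = subst (β <_) (sym length≡) (+-monoˡ-≤ β 1≤α)
    α< : α < length s
    α< = subst (α <_) (sym length≡) (subst (_≤ α + β) (+-comm α 1) (+-monoʳ-≤ α 1≤β))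

  -- No period is smaller than both α + 1 and β + 1: by Fine–Wilf it would yield a
  -- period dividing α + 1, hence one coprime to β + 1, hence the period 1.
  no-short-period : ∀ e → 1 ≤ e → e ≤ α → e ≤ β → ¬ Period e s
  no-short-period e 1≤e e≤α e≤β perE =
    not-constant (≤-trans 1≤e e≤α) (≤-trans 1≤e e≤β)
      (fineWilf-coprime g (suc β) s 1≤g (s≤s z≤n) perG period-β coprimeG (bound-β g g≤α))
    where
    g = gcd e (suc α)
    1≤g : 1 ≤ g
    1≤g = gcd-pos e (suc α) (s≤s z≤n)
    g≤α : g ≤ α
    g≤α = ≤-trans (∣⇒≤ {{>-nonZero 1≤e}} (gcd[m,n]∣m e (suc α))) e≤α
    perG : Period g s
    perG = fineWilf e (suc α) s 1≤e (s≤s z≤n) perE period-α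
             (≤-trans (bound-α e e≤β) (+-monoʳ-≤ (length s) 1≤g))
    coprimeG : Coprime g (suc β)
    coprimeG (d∣g , d∣β) = coprime (∣-trans d∣g (gcd[m,n]∣n e (suc α)) , d∣β)

  π-central : π s ≡ suc α ⊓ suc β
  π-central with ≤-total α β
  ... | inj₁ α≤β =
    trans (π-least (suc α) s (s≤s z≤n) (s≤s (subst (α ≤_) (sym length≡) (m≤m+n α β))) period-α
             (λ e 1≤e e< → no-short-period e 1≤e (≤-pred e<) (≤-trans (≤-pred e<) α≤β)))
          (sym (m≤n⇒m⊓n≡m (s≤s α≤β)))
  ... | inj₂ β≤α =
    trans (π-least (suc β) s (s≤s z≤n) (s≤s β≤|s|) period-β
             (λ e 1≤e e< → no-short-period e 1≤e (≤-trans (≤-pred e<) β≤α) (≤-pred e<)))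
          (sym (m≥n⇒m⊓n≡n (s≤s β≤α)))

  -- For j < β the suffix drop j (s ++ [x]) is not a palindrome: it would make j + 1
  -- a period of s with x at position j, and by Fine–Wilf (with α + 1) this is impossible.
  no-long-pal-suffix : ∀ j → j < β → ¬ IsPal (drop j (s ++ x ∷ []))
  no-long-pal-suffix j j<β pal = byGcd (g ≟ suc α)
    where
    j<|s| : j < length s
    j<|s| = <-≤-trans j<β β≤|s|
    letterJ×perJ : (s ‼ j ≡ just x) × Period (suc j) s
    letterJ×perJ = pal-suffix⇒period s j x palindrome j<|s| (subst IsPal (drop-++ˡ j s (x ∷ []) (<⇒≤ j<|s|)) pal)
    g = gcd (suc j) (suc α)
    1≤g : 1 ≤ g
    1≤g = gcd-pos (suc j) (suc α) (s≤s z≤n)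
    perG : Period g s
    perG = fineWilf (suc j) (suc α) s (s≤s z≤n) (s≤s z≤n) (proj₂ letterJ×perJ) period-α
             (≤-trans (bound-α (suc j) j<β) (+-monoʳ-≤ (length s) 1≤g))
    -- if α + 1 divides j + 1, position j repeats position α, which carries y ≠ x
    multiple : suc α ∣ suc j → ⊥
    multiple (divides (suc m) j+1≡) = x≢y (just-injective (begin
        just x               ≡⟨ sym (proj₁ letterJ×perJ) ⟩
        s ‼ j                ≡⟨ cong (s ‼_) j≡ ⟩
        s ‼ (α + m * suc α)  ≡⟨ sym (period-iterate (suc α) (length s) s period-α m α (subst (_< length s) j≡ j<|s|)) ⟩
        s ‼ α                ≡⟨ letter-α (≤-trans (s≤s z≤n) j<β) ⟩
        just y               ∎))
      where
      open ≡-Reasoning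
      j≡ : j ≡ α + m * suc α
      j≡ = suc-injective j+1≡
    byGcd : Dec (g ≡ suc α) → ⊥
    byGcd (yes g≡) = multiple (subst (_∣ suc j) g≡ (gcd[m,n]∣m (suc j) (suc α)))
    byGcd (no g≢) = no-short-period g 1≤g (≤-pred (≤∧≢⇒< (∣⇒≤ (gcd[m,n]∣n (suc j) (suc α))) g≢))
                      (≤-trans (∣⇒≤ (gcd[m,n]∣m (suc j) (suc α))) j<β) perG

  -- The candidate palindromic suffix of s x: the last α letters of s, then x.
  suffix : Word
  suffix = drop β s ++ x ∷ []

  |drop-β| : length (drop β s) ≡ α
  |drop-β| = +-cancelʳ-≡ β (length (drop β s)) α (trans (length-drop+ β s β≤|s|) length≡)

  |suffix| : length suffix ≡ suc α
  |suffix| = trans (length-++ (drop β s)) (trans (cong (_+ 1) |drop-β|) (+-comm α 1))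

  suffix-inner : ∀ k → suc k < suc α → suffix ‼ k ≡ s ‼ (β + k)
  suffix-inner k k< = trans (‼-++ˡ (drop β s) (x ∷ []) k (subst (k <_) (sym |drop-β|) (≤-pred k<))) (‼-drop β s k)

  suffix-first : 1 ≤ α → suffix ‼ 0 ≡ just x
  suffix-first 1≤α = trans (suffix-inner 0 (s≤s 1≤α)) (trans (cong (s ‼_) (+-identityʳ β)) (letter-β 1≤α))

  suffix-last : suffix ‼ α ≡ just x
  suffix-last = trans (cong (suffix ‼_) (trans (sym (+-identityʳ α)) (cong (_+ 0) (sym |drop-β|))))
                      (‼-++ʳ (drop β s) (x ∷ []) 0)

  -- Inner mirror positions of the suffix: reflect in s, then shift by the period β + 1.
  suffix-mirror-inner : ∀ k₁ k₂ → suc (suc (k₁ + k₂)) ≡ α → suffix ‼ suc k₁ ≡ suffix ‼ suc k₂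
  suffix-mirror-inner k₁ k₂ e = begin
      suffix ‼ suc k₁       ≡⟨ suffix-inner (suc k₁) (s≤s k₁<) ⟩
      s ‼ (β + suc k₁)      ≡⟨ cong (s ‼_) (solve 2 (λ β k → β :+ (con 1 :+ k) := k :+ (con 1 :+ β)) refl β k₁) ⟩
      s ‼ (k₁ + suc β)      ≡⟨ sym (period-β k₁ k₁+β<) ⟩
      s ‼ k₁                ≡⟨ mirror k₁ (β + suc k₂) e₄ ⟩
      s ‼ (β + suc k₂)      ≡⟨ sym (suffix-inner (suc k₂) (s≤s k₂<)) ⟩
      suffix ‼ suc k₂       ∎
    where
    open ≡-Reasoning
    k₁< : suc k₁ < α
    k₁< = subst (suc (suc k₁) ≤_) e (s≤s (s≤s (m≤m+n k₁ k₂)))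
    k₂< : suc k₂ < α
    k₂< = subst (suc (suc k₂) ≤_) e (s≤s (s≤s (m≤n+m k₂ k₁)))
    k₁+β< : k₁ + suc β < length s
    k₁+β< = subst (k₁ + suc β <_) (sym length≡)
              (subst (_≤ α + β) (solve 2 (λ k β → con 2 :+ k :+ β := con 1 :+ (k :+ (con 1 :+ β))) refl k₁ β)
                (+-monoˡ-≤ β k₁<))
    e₄ : suc (k₁ + (β + suc k₂)) ≡ length s
    e₄ = trans (solve 3 (λ k₁ k₂ β → con 1 :+ (k₁ :+ (β :+ (con 1 :+ k₂))) := con 2 :+ (k₁ :+ k₂) :+ β) refl k₁ k₂ β)
           (trans (cong (_+ β) e) (sym length≡))

  suffix-mirror : Mirror suffix
  suffix-mirror k₁ k₂ e = mirrorSum k₁ k₂ (suc-injective (trans e |suffix|))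
    where
    mirrorSum : ∀ k₁ k₂ → k₁ + k₂ ≡ α → suffix ‼ k₁ ≡ suffix ‼ k₂
    mirrorSum zero zero _ = refl
    mirrorSum zero (suc k) e = trans (suffix-first (subst (1 ≤_) e (s≤s z≤n))) (trans (sym suffix-last) (cong (suffix ‼_) (sym e)))
    mirrorSum (suc k) zero e = trans (cong (suffix ‼_) e′) (trans suffix-last (sym (suffix-first (subst (1 ≤_) e′ (s≤s z≤n)))))
      where
      e′ : suc k ≡ α
      e′ = trans (sym (+-identityʳ (suc k))) e
    mirrorSum (suc k₁) (suc k₂) e = suffix-mirror-inner k₁ k₂ (trans (cong suc (sym (+-suc k₁ k₂))) e)

  pal-suffix : IsPal (drop β (s ++ x ∷ []))
  pal-suffix = subst IsPal (sym (drop-++ˡ β s (x ∷ []) β≤|s|)) (mirror⇒pal suffix suffix-mirror)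

  extension : Word
  extension = s ++ x ∷ reverse (take β s)

  extension≡ : (s ++ x ∷ []) ++ reverse (take β (s ++ x ∷ [])) ≡ extension
  extension≡ = trans (cong (λ z → (s ++ x ∷ []) ++ reverse z) (take-++ˡ β s (x ∷ []) β≤|s|))
                     (++-assoc s (x ∷ []) (reverse (take β s)))

  closure : palClosure (s ++ x ∷ []) ≡ extension
  closure = trans (palClosure-char β (s ++ x ∷ []) β≤|s++x| no-long-pal-suffix pal-suffix) extension≡
    where
    β≤|s++x| : β ≤ length (s ++ x ∷ [])
    β≤|s++x| = ≤-trans β≤|s| (subst (length s ≤_) (sym (length-++ s)) (m≤m+n (length s) 1))

  |take-β| : length (take β s) ≡ β
  |take-β| = length-take≤ β s β≤|s|

  |extension| : length extension ≡ length s + suc β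
  |extension| = trans (length-++ s) (cong (λ n → length s + suc n) (trans (length-reverse (take β s)) |take-β|))

  extension-left : ∀ i → i < length s → extension ‼ i ≡ s ‼ i
  extension-left i i< = ‼-++ˡ s (x ∷ reverse (take β s)) i i<

  extension-middle : extension ‼ length s ≡ just x
  extension-middle = trans (cong (extension ‼_) (sym (+-identityʳ (length s)))) (‼-++ʳ s (x ∷ reverse (take β s)) 0)

  extension-right : ∀ k j → suc (k + j) ≡ β → extension ‼ (length s + suc k) ≡ s ‼ j
  extension-right k j e = trans (‼-++ʳ s (x ∷ reverse (take β s)) (suc k))
                            (trans (‼-reverse (take β s) k j (trans e (sym |take-β|)))
                              (‼-take β s j (subst (j <_) e (s≤s (m≤n+m j k)))))

  extension-period-β : Period (suc β) extension
  extension-period-β i i+β< with <-cmp (i + suc β) (length s)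
  ... | tri< inside _ _ = trans (extension-left i (≤-<-trans (m≤m+n i (suc β)) inside))
                            (trans (period-β i inside) (sym (extension-left (i + suc β) inside)))
  ... | tri≈ _ atMiddle _ =
    trans (extension-left i i<) (trans (mirror i β e₁)
      (trans (letter-β 1≤α) (trans (sym extension-middle) (cong (extension ‼_) (sym atMiddle)))))
    where
    e₁ : suc (i + β) ≡ length s
    e₁ = trans (sym (+-suc i β)) atMiddle
    i< : i < length s
    i< = subst (i <_) atMiddle (m<m+n i (s≤s z≤n))
    1≤α : 1 ≤ α
    1≤α = +-cancelʳ-≤ β 1 α (subst (suc β ≤_) (trans atMiddle length≡) (m≤n+m (suc β) i))
  ... | tri> _ _ beyond = sym (trans (cong (extension ‼_) (sym e₂))
                            (trans (extension-right k j ej) (trans (sym (mirror i j eij)) (sym (extension-left i i<)))))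
    where
    k = i + suc β ∸ suc (length s)
    e₂ : length s + suc k ≡ i + suc β
    e₂ = trans (+-suc (length s) k) (m+[n∸m]≡n beyond)
    k<β : suc k ≤ β
    k<β = ≤-pred (+-cancelˡ-≤ (length s) (suc (suc k)) (suc β)
            (subst (_≤ length s + suc β) (sym (+-suc (length s) (suc k)))
              (subst (suc (length s + suc k) ≤_) |extension| (subst (λ z → suc z ≤ length extension) (sym e₂) i+β<))))
    j = β ∸ suc k
    ej : suc (k + j) ≡ β
    ej = m+[n∸m]≡n k<β
    eij : suc (i + j) ≡ length s
    eij = +-cancelʳ-≡ (suc k) (suc (i + j)) (length s)
            (trans (solve 3 (λ i j k → con 1 :+ (i :+ j) :+ (con 1 :+ k) := i :+ (con 1 :+ (con 1 :+ (k :+ j)))) refl i j k)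
              (trans (cong (λ z → i + suc z) ej) (sym e₂)))
    i< : i < length s
    i< = subst (i <_) eij (s≤s (m≤m+n i j))

  -- The new long period (α + 1) + (β + 1) = |extension| + 1 - β.
  extension-period-sum : Period (suc α + suc β) extension
  extension-period-sum i i+p< =
    trans (extension-left i i<) (trans (period-α i i+α<)
      (trans (mirror (i + suc α) j e₃) (sym (trans (cong (extension ‼_) e₁) (extension-right (suc i) j ej)))))
    where
    e₁ : i + (suc α + suc β) ≡ length s + suc (suc i)
    e₁ = trans (solve 3 (λ i α β → i :+ ((con 1 :+ α) :+ (con 1 :+ β)) := (α :+ β) :+ (con 1 :+ (con 1 :+ i))) refl i α β)
               (cong (_+ suc (suc i)) (sym length≡))
    i+2≤β : suc (suc i) ≤ β
    i+2≤β = ≤-pred (+-cancelˡ-≤ (length s) (suc (suc (suc i))) (suc β)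
              (subst (_≤ length s + suc β) (sym (+-suc (length s) (suc (suc i))))
                (subst (suc (length s + suc (suc i)) ≤_) |extension| (subst (λ z → suc z ≤ length extension) e₁ i+p<))))
    j = β ∸ suc (suc i)
    ej : suc (suc i + j) ≡ β
    ej = m+[n∸m]≡n i+2≤β
    i< : i < length s
    i< = ≤-trans (≤-trans (n≤1+n (suc i)) i+2≤β) β≤|s|
    i+α< : i + suc α < length s
    i+α< = subst (i + suc α <_) (sym length≡)
             (subst (_≤ α + β) (solve 2 (λ i α → α :+ (con 2 :+ i) := con 1 :+ (i :+ (con 1 :+ α))) refl i α) (+-monoʳ-≤ α i+2≤β))
    e₃ : suc (i + suc α + j) ≡ length s
    e₃ = trans (solve 3 (λ i α j → con 1 :+ (i :+ (con 1 :+ α) :+ j) := α :+ (con 1 :+ ((con 1 :+ i) :+ j))) refl i α j)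
           (trans (cong (α +_) ej) (sym length≡))

  extension-letter-β : extension ‼ β ≡ just x
  extension-letter-β with <-cmp β (length s)
  ... | tri< β< _ _ = trans (extension-left β β<) (letter-β (+-cancelʳ-≤ β 1 α (subst (suc β ≤_) length≡ β<)))
  ... | tri≈ _ β≡ _ = trans (cong (extension ‼_) β≡) extension-middle
  ... | tri> _ _ β> = ⊥-elim (<⇒≱ β> β≤|s|)

  extension-letter-α : 1 ≤ β → extension ‼ suc (α + β) ≡ just y
  extension-letter-α 1≤β = trans (cong (extension ‼_) e₀) (trans (extension-right 0 j ej) (trans (mirror j α e₂) (letter-α 1≤β)))
    where
    e₀ : suc (α + β) ≡ length s + suc 0
    e₀ = trans (+-comm 1 (α + β)) (cong (_+ 1) (sym length≡))
    j = β ∸ 1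
    ej : suc (0 + j) ≡ β
    ej = m+[n∸m]≡n 1≤β
    e₂ : suc (j + α) ≡ length s
    e₂ = trans (cong (_+ α) ej) (trans (+-comm β α) (sym length≡))

  extension-central : Central x y (suc (α + β)) β extension
  extension-central = record
    { palindrome = subst IsPal extension≡ (pal-suffix⇒pal-extension β (s ++ x ∷ []) pal-suffix)
    ; length≡ = trans |extension| (trans (cong (_+ suc β) length≡) (+-suc (α + β) β))
    ; period-α = subst (λ p → Period p extension) (cong suc (+-suc α β)) extension-period-sum
    ; period-β = extension-period-β
    ; coprime = subst (λ p → Coprime p (suc β)) (trans (+-comm (suc β) (suc α)) (cong suc (+-suc α β))) (coprime-+ coprime)
    ; letter-β = λ _ → extension-letter-β
    ; letter-α = extension-letter-α
    }

count-++ : (c : Letter) (u v : Word) → count c (u ++ v) ≡ count c u + count c v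
count-++ c [] v = refl
count-++ c (y ∷ u) v with c ==ᴸ y
... | true = cong suc (count-++ c u v)
... | false = count-++ c u v

count-reverse : (c : Letter) (u : Word) → count c (reverse u) ≡ count c u
count-reverse c [] = refl
count-reverse c (y ∷ u) = begin
    count c (reverse (y ∷ u))                 ≡⟨ cong (count c) (unfold-reverse y u) ⟩
    count c (reverse u ++ y ∷ [])             ≡⟨ count-++ c (reverse u) (y ∷ []) ⟩
    count c (reverse u) + count c (y ∷ [])    ≡⟨ cong (_+ count c (y ∷ [])) (count-reverse c u) ⟩
    count c u + count c (y ∷ [])              ≡⟨ last-letter (c ==ᴸ y) ⟩
    count c (y ∷ u)                           ∎
  where
  open ≡-Reasoning
  last-letter : (t : Bool) → count c u + (if t then 1 else 0) ≡ (if t then suc (count c u) else count c u)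
  last-letter true = +-comm (count c u) 1
  last-letter false = +-identityʳ (count c u)

-- Counting in s ++ x ∷ reverse P; for concrete letters count c (x ∷ P) computes.
count-extension : (c x : Letter) (s P : Word) → count c (s ++ x ∷ reverse P) ≡ count c s + count c (x ∷ P)
count-extension c x s P = begin
    count c (s ++ x ∷ reverse P)               ≡⟨ count-++ c s (x ∷ reverse P) ⟩
    count c s + count c (x ∷ reverse P)        ≡⟨ cong (λ n → count c s + (if c ==ᴸ x then suc n else n)) (count-reverse c P) ⟩
    count c s + count c (x ∷ P)                ∎
  where open ≡-Reasoning

-- The matrix of a directive word

record Matrix : Set where
  constructor matrix
  field n₁ n₂ n₃ n₄ : ℕ

identity : Matrix
identity = matrix 1 0 0 1

-- Right multiplication by the elementary matrix of a letter: a adds the second column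
-- to the first, b adds the first column to the second.
_·ʳ_ : Matrix → Letter → Matrix
matrix n₁ n₂ n₃ n₄ ·ʳ a = matrix (n₁ + n₂) n₂ (n₃ + n₄) n₄
matrix n₁ n₂ n₃ n₄ ·ʳ b = matrix n₁ (n₁ + n₂) n₃ (n₃ + n₄)

-- Left multiplication by the same elementary matrices (a: row 2 += row 1; b: row 1 += row 2).
_·ˡ_ : Letter → Matrix → Matrix
a ·ˡ matrix n₁ n₂ n₃ n₄ = matrix n₁ n₂ (n₁ + n₃) (n₂ + n₄)
b ·ˡ matrix n₁ n₂ n₃ n₄ = matrix (n₁ + n₃) (n₂ + n₄) n₃ n₄

_·ʳ*_ : Matrix → Word → Matrix
M ·ʳ* [] = M
M ·ʳ* (x ∷ v) = (M ·ʳ x) ·ʳ* v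

-- Transposition along the anti-diagonal, which reverses products of elementary matrices.
antiTranspose : Matrix → Matrix
antiTranspose (matrix n₁ n₂ n₃ n₄) = matrix n₄ n₂ n₃ n₁

·ˡ-·ʳ-assoc : (y x : Letter) (M : Matrix) → (y ·ˡ M) ·ʳ x ≡ y ·ˡ (M ·ʳ x)
·ˡ-·ʳ-assoc a a (matrix n₁ n₂ n₃ n₄) = cong (λ n → matrix (n₁ + n₂) n₂ n (n₂ + n₄)) (interchange n₁ n₃ n₂ n₄)
·ˡ-·ʳ-assoc a b (matrix n₁ n₂ n₃ n₄) = cong (matrix n₁ (n₁ + n₂) (n₁ + n₃)) (interchange n₁ n₃ n₂ n₄)
·ˡ-·ʳ-assoc b a (matrix n₁ n₂ n₃ n₄) = cong (λ n → matrix n (n₂ + n₄) (n₃ + n₄) n₄) (interchange n₁ n₃ n₂ n₄)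
·ˡ-·ʳ-assoc b b (matrix n₁ n₂ n₃ n₄) = cong (λ n → matrix (n₁ + n₃) n n₃ (n₃ + n₄)) (interchange n₁ n₃ n₂ n₄)

·ˡ-·ʳ*-assoc : (y : Letter) (M : Matrix) (v : Word) → (y ·ˡ M) ·ʳ* v ≡ y ·ˡ (M ·ʳ* v)
·ˡ-·ʳ*-assoc y M [] = refl
·ˡ-·ʳ*-assoc y M (x ∷ v) = trans (cong (_·ʳ* v) (·ˡ-·ʳ-assoc y x M)) (·ˡ-·ʳ*-assoc y (M ·ʳ x) v)

·ʳ*-snoc : (M : Matrix) (v : Word) (x : Letter) → M ·ʳ* (v ++ x ∷ []) ≡ (M ·ʳ* v) ·ʳ x
·ʳ*-snoc M [] x = refl
·ʳ*-snoc M (y ∷ v) x = ·ʳ*-snoc (M ·ʳ y) v x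

antiTranspose-·ʳ : (x : Letter) (M : Matrix) → antiTranspose M ·ʳ x ≡ antiTranspose (x ·ˡ M)
antiTranspose-·ʳ a (matrix n₁ n₂ n₃ n₄) = cong₂ (λ m n → matrix m n₂ n n₁) (+-comm n₄ n₂) (+-comm n₃ n₁)
antiTranspose-·ʳ b (matrix n₁ n₂ n₃ n₄) = cong₂ (λ m n → matrix n₄ m n₃ n) (+-comm n₄ n₂) (+-comm n₃ n₁)

matrix-reverse : (v : Word) → identity ·ʳ* reverse v ≡ antiTranspose (identity ·ʳ* v)
matrix-reverse [] = refl
matrix-reverse (x ∷ v) = begin
  identity ·ʳ* reverse (x ∷ v)                 ≡⟨ cong (identity ·ʳ*_) (unfold-reverse x v) ⟩
  identity ·ʳ* (reverse v ++ x ∷ [])           ≡⟨ ·ʳ*-snoc identity (reverse v) x ⟩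
  (identity ·ʳ* reverse v) ·ʳ x                ≡⟨ cong (_·ʳ x) (matrix-reverse v) ⟩
  antiTranspose (identity ·ʳ* v) ·ʳ x          ≡⟨ antiTranspose-·ʳ x (identity ·ʳ* v) ⟩
  antiTranspose (x ·ˡ (identity ·ʳ* v))        ≡⟨ cong antiTranspose (sym (·ˡ-·ʳ*-assoc x identity v)) ⟩
  antiTranspose ((x ·ˡ identity) ·ʳ* v)        ≡⟨ cong (λ M → antiTranspose (M ·ʳ* v)) (identity-commutes x) ⟩
  antiTranspose (identity ·ʳ* (x ∷ v))         ∎
  where
  open ≡-Reasoning
  identity-commutes : (x : Letter) → x ·ˡ identity ≡ identity ·ʳ x
  identity-commutes a = refl
  identity-commutes b = refl

-- s is central (letters a, b) and the matrix M records its data: the column sums are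
-- the periods α + 1 and β + 1, the row sums are |s|_a + 1 and |s|_b + 1, and the
-- columns count the letters in the prefixes of length α and β.
record Standard (s : Word) (M : Matrix) : Set where
  open Matrix M
  field
    α β : ℕ
    central : Central a b α β s
    column-α : n₁ + n₃ ≡ suc α
    column-β : n₂ + n₄ ≡ suc β
    row-a : count a s + 1 ≡ n₃ + n₄
    row-b : count b s + 1 ≡ n₁ + n₂
    prefix-α-a : count a (take α s) ≡ n₃
    prefix-α-b : count b (take α s) + 1 ≡ n₁
    prefix-β-a : count a (take β s) + 1 ≡ n₄
    prefix-β-b : count b (take β s) ≡ n₂

standard-empty : Standard [] identity
standard-empty = record
  { α = 0 ; β = 0
  ; central = record
    { palindrome = refl ; length≡ = refl ; period-α = λ _ () ; period-β = λ _ ()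
    ; coprime = 1-coprimeTo 1 ; letter-β = λ () ; letter-α = λ () }
  ; column-α = refl ; column-β = refl ; row-a = refl ; row-b = refl
  ; prefix-α-a = refl ; prefix-α-b = refl ; prefix-β-a = refl ; prefix-β-b = refl
  }

prefix-of-extension : (s : Word) (x : Letter) (R : Word) (n : ℕ) → length s ≡ n →
                      take (suc n) (s ++ x ∷ R) ≡ s ++ x ∷ []
prefix-of-extension s x R n |s|≡n =
  trans (cong (λ k → take k (s ++ x ∷ R)) (trans (+-comm 1 n) (cong (_+ 1) (sym |s|≡n)))) (take-++ʳ s (x ∷ R) 1)

standard-step-a : (s : Word) (M : Matrix) → Standard s M → Standard (palClosure (s ++ a ∷ [])) (M ·ʳ a)
standard-step-a s (matrix n₁ n₂ n₃ n₄) st = subst (λ w → Standard w _) (sym closure) (record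
  { α = suc (α + β) ; β = β
  ; central = extension-central
  ; column-α = trans (interchange n₁ n₂ n₃ n₄) (trans (cong₂ _+_ column-α column-β) (cong suc (+-suc α β)))
  ; column-β = column-β
  ; row-a = begin
      count a extension + 1                 ≡⟨ cong (_+ 1) (count-extension a a s P) ⟩
      count a s + suc (count a P) + 1       ≡⟨ solve 2 (λ m n → m :+ (con 1 :+ n) :+ con 1 := (m :+ con 1) :+ (n :+ con 1)) refl (count a s) (count a P) ⟩
      (count a s + 1) + (count a P + 1)     ≡⟨ cong₂ _+_ row-a prefix-β-a ⟩
      n₃ + n₄ + n₄                          ∎
  ; row-b = begin
      count b extension + 1                 ≡⟨ cong (_+ 1) (count-extension b a s P) ⟩
      count b s + count b P + 1             ≡⟨ solve 2 (λ m n → m :+ n :+ con 1 := (m :+ con 1) :+ n) refl (count b s) (count b P) ⟩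
      (count b s + 1) + count b P           ≡⟨ cong₂ _+_ row-b prefix-β-b ⟩
      n₁ + n₂ + n₂                          ∎
  ; prefix-α-a = trans (cong (count a) newPrefix) (trans (count-++ a s (a ∷ [])) row-a)
  ; prefix-α-b = trans (cong (λ w → count b w + 1) newPrefix)
                   (trans (cong (_+ 1) (trans (count-++ b s (a ∷ [])) (+-identityʳ (count b s)))) row-b)
  ; prefix-β-a = trans (cong (λ w → count a w + 1) oldPrefix) prefix-β-a
  ; prefix-β-b = trans (cong (count b) oldPrefix) prefix-β-b
  })
  where
  open Standard st
  open Central central using (length≡)
  open CentralWord central (λ ())
  open ≡-Reasoning
  P = take β s
  oldPrefix : take β extension ≡ P
  oldPrefix = take-++ˡ β s (a ∷ reverse P) β≤|s|
  newPrefix : take (suc (α + β)) extension ≡ s ++ a ∷ []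
  newPrefix = prefix-of-extension s a (reverse P) (α + β) length≡

standard-step-b : (s : Word) (M : Matrix) → Standard s M → Standard (palClosure (s ++ b ∷ [])) (M ·ʳ b)
standard-step-b s (matrix n₁ n₂ n₃ n₄) st = subst (λ w → Standard w _) (sym closure) (record
  { α = α ; β = suc (β + α)
  ; central = central-swap extension-central
  ; column-α = column-α
  ; column-β = trans (interchange n₁ n₂ n₃ n₄) (trans (+-comm (n₁ + n₃) (n₂ + n₄)) (trans (cong₂ _+_ column-β column-α) (cong suc (+-suc β α))))
  ; row-a = begin
      count a extension + 1                 ≡⟨ cong (_+ 1) (count-extension a b s P) ⟩
      count a s + count a P + 1             ≡⟨ solve 2 (λ m n → m :+ n :+ con 1 := n :+ (m :+ con 1)) refl (count a s) (count a P) ⟩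
      count a P + (count a s + 1)           ≡⟨ cong₂ _+_ prefix-α-a row-a ⟩
      n₃ + (n₃ + n₄)                        ∎
  ; row-b = begin
      count b extension + 1                 ≡⟨ cong (_+ 1) (count-extension b b s P) ⟩
      count b s + suc (count b P) + 1       ≡⟨ solve 2 (λ m n → m :+ (con 1 :+ n) :+ con 1 := (n :+ con 1) :+ (m :+ con 1)) refl (count b s) (count b P) ⟩
      (count b P + 1) + (count b s + 1)     ≡⟨ cong₂ _+_ prefix-α-b row-b ⟩
      n₁ + (n₁ + n₂)                        ∎
  ; prefix-α-a = trans (cong (count a) oldPrefix) prefix-α-a
  ; prefix-α-b = trans (cong (λ w → count b w + 1) oldPrefix) prefix-α-b
  ; prefix-β-a = trans (cong (λ w → count a w + 1) newPrefix)
                   (trans (cong (_+ 1) (trans (count-++ a s (b ∷ [])) (+-identityʳ (count a s)))) row-a)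
  ; prefix-β-b = trans (cong (count b) newPrefix) (trans (count-++ b s (b ∷ [])) row-b)
  })
  where
  open Standard st
  open Central central using (length≡)
  open CentralWord (central-swap central) (λ ())
  open ≡-Reasoning
  P = take α s
  oldPrefix : take α extension ≡ P
  oldPrefix = take-++ˡ α s (b ∷ reverse P) β≤|s|
  newPrefix : take (suc (β + α)) extension ≡ s ++ b ∷ []
  newPrefix = prefix-of-extension s b (reverse P) (β + α) (trans length≡ (+-comm α β))

standard-step : (x : Letter) (s : Word) (M : Matrix) → Standard s M → Standard (palClosure (s ++ x ∷ [])) (M ·ʳ x)
standard-step a = standard-step-a
standard-step b = standard-step-b

standard-ψAcc : (s : Word) (M : Matrix) (v : Word) → Standard s M → Standard (ψAcc s v) (M ·ʳ* v)
standard-ψAcc s M [] st = st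
standard-ψAcc s M (x ∷ v) st = standard-ψAcc (palClosure (s ++ x ∷ [])) (M ·ʳ x) v (standard-step x s M st)

standard-ψ : (v : Word) → Standard (ψ v) (identity ·ʳ* v)
standard-ψ v = standard-ψAcc [] identity v standard-empty

-- The periods of ψ(ṽ) are read off the anti-transposed matrix: they are |ψ(v)|_a + 1
-- and |ψ(v)|_b + 1, and π is the smaller one.
π-ψ-reverse : (v : Word) → π (ψ (reverse v)) ≡ (count a (ψ v) + 1) ⊓ (count b (ψ v) + 1)
π-ψ-reverse v with identity ·ʳ* v | standard-ψ v | matrix-reverse v
... | matrix n₁ n₂ n₃ n₄ | stᵥ | M̃≡ = begin
    π (ψ (reverse v))                          ≡⟨ CentralWord.π-central central (λ ()) ⟩
    suc α ⊓ suc β                              ≡⟨ cong₂ _⊓_ (sym column-α) (sym column-β) ⟩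
    (n₄ + n₃) ⊓ (n₂ + n₁)                      ≡⟨ cong₂ _⊓_ (trans (+-comm n₄ n₃) (sym (Standard.row-a stᵥ)))
                                                            (trans (+-comm n₂ n₁) (sym (Standard.row-b stᵥ))) ⟩
    (count a (ψ v) + 1) ⊓ (count b (ψ v) + 1)  ∎
  where
  open ≡-Reasoning
  open Standard (subst (Standard (ψ (reverse v))) M̃≡ (standard-ψ (reverse v)))

-- When v begins with a, the top row of its matrix is dominated by the bottom row.
RowDominated : Matrix → Set
RowDominated (matrix n₁ n₂ n₃ n₄) = (n₁ ≤ n₃) × (n₂ ≤ n₄)

rowDominated-·ʳ* : (M : Matrix) (v : Word) → RowDominated M → RowDominated (M ·ʳ* v)
rowDominated-·ʳ* M [] dom = dom
rowDominated-·ʳ* (matrix n₁ n₂ n₃ n₄) (a ∷ v) (d₁ , d₂) = rowDominated-·ʳ* _ v (+-mono-≤ d₁ d₂ , d₂)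
rowDominated-·ʳ* (matrix n₁ n₂ n₃ n₄) (b ∷ v) (d₁ , d₂) = rowDominated-·ʳ* _ v (d₁ , +-mono-≤ d₁ d₂)

-- |ψ(a v′)|_b ≤ |ψ(a v′)|_a, compared through the row sums of the matrix.
count-b≤count-a : (v′ : Word) → count b (ψ (a ∷ v′)) + 1 ≤ count a (ψ (a ∷ v′)) + 1
count-b≤count-a v′ with identity ·ʳ* (a ∷ v′) | standard-ψ (a ∷ v′) | rowDominated-·ʳ* (identity ·ʳ a) v′ (≤-refl , z≤n)
... | matrix n₁ n₂ n₃ n₄ | st | (d₁ , d₂) = subst₂ _≤_ (sym (Standard.row-b st)) (sym (Standard.row-a st)) (+-mono-≤ d₁ d₂)

lemma4p7 : (p q : ℕ) → 1 ≤ p → 1 ≤ q → Coprime p q →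
    (v : Word) → christoffel p q ≡ a ∷ (ψ v ++ (b ∷ [])) →
    (π (ψ (reverse v)) ≡ count a (christoffel p q) ⊓ count b (christoffel p q))
    × ((v′ : Word) → v ≡ a ∷ v′ → π (ψ (reverse v)) ≡ count b (ψ v) + 1)
lemma4p7 p q _ _ _ v w≡ = minimum , startingWithA
  where
  count-a : count a (christoffel p q) ≡ count a (ψ v) + 1
  count-a = trans (cong (count a) w≡) (trans (cong suc (trans (count-++ a (ψ v) (b ∷ [])) (+-identityʳ _))) (+-comm 1 _))
  count-b : count b (christoffel p q) ≡ count b (ψ v) + 1
  count-b = trans (cong (count b) w≡) (count-++ b (ψ v) (b ∷ []))
  minimum : π (ψ (reverse v)) ≡ count a (christoffel p q) ⊓ count b (christoffel p q)
  minimum = trans (π-ψ-reverse v) (sym (cong₂ _⊓_ count-a count-b))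
  startingWithA : (v′ : Word) → v ≡ a ∷ v′ → π (ψ (reverse v)) ≡ count b (ψ v) + 1
  startingWithA v′ refl = trans (π-ψ-reverse (a ∷ v′)) (m≥n⇒m⊓n≡n (count-b≤count-a v′))
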